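{- Let $r\geq 1$ and let $G$ be a central product of $r$ copies of the quaternion group $Q_8$ (with amalgamated centres). Then there is a closed linked system of semiregular relative difference sets in $G$ with forbidden subgroup $Z(G)$ and parameters $$(m,n,k,\lambda,s,\mu,\nu)=(2^{2r},2,2^{2r},2^{2r-1},2,2^{2r-1}-2^r+2^{r-1},2^{2r-1}+2^{r-1}).$$
   Context: For $X\subseteq G$, $\underline{X}=\sum_{x\in X}x\in\mathbb{Z}G$, $X^{(-1)}=\{x^{ -1}:x\in X\}$, $e$ the identity. For $N\leq G$, $X$ is a relative difference set (RDS) relative to $N$ with parameters $(m,n,k,\lambda)$ if $\underline{X}\cdot\underline{X^{(-1)}}=ke+\lambda(\underline{G}-\underline{N})$, $k=|X|$, $m=|G:N|$, $n=|N|$, $\lambda>0$; semiregular means $|X\cap Ng|=1$ for all $g$. A collection $\{X_\alpha:\alpha\in S\}$ of RDSs in $G$ with common forbidden subgroup $N$ and parameters $(m,n,k,\lambda)$, $|S|=s\geq2$, is a closed linked system with parameters $(m,n,k,\lambda,s,\mu,\nu)$ if there are a bijection $\chi:S\to S$, a function $\psi:(S\times S)\setminus\{(\alpha,\chi(\alpha))\}\to S$ and integers $\mu,\nu\geq0$ with $X_\alpha^{(-1)}=X_{\chi(\alpha)}$, $\underline{X_\alpha}\cdot\underline{X_\beta}=ke+\lambda(\underline{G}-\underline{N})$ when $\beta=\chi(\alpha)$, and $\underline{X_\alpha}\cdot\underline{X_\beta}=\mu\underline{X_{\psi(\alpha,\beta)}}+\nu(\underline{G}-\underline{X_{\psi(\alpha,\beta)}})$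 otherwise. -}

module Defs where

open import Data.Bool using (Bool; true; false; _xor_; _∧_; not; if_then_else_; T)
open import Data.Nat using (ℕ; zero; suc; _+_; _*_; _<_; _≤_)
open import Data.Product using (_×_; _,_; Σ; Σ-syntax)
open import Data.List using (List; []; _∷_; map; concatMap; length)
open import Data.Vec using (Vec; []; _∷_; zipWith; replicate)
open import Data.Fin using (Fin)
open import Relation.Binary.PropositionalEquality using (_≡_; _≢_)
open import Function.Definitions using (Bijective)

-- The quaternion group Q8 = {±1, ±i, ±j, ±k}.
-- An element is (sign , unit): sign = true means the negative element.

data U : Set where
  u1 ui uj uk : U

allU : List U
allU = u1 ∷ ui ∷ uj ∷ uk ∷ []

umul : U → U → Bool × U
umul u1 v  = false , v
umul ui u1 = false , ui
umul ui ui = true  , u1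
umul ui uj = false , uk
umul ui uk = true  , uj
umul uj u1 = false , uj
umul uj ui = true  , uk
umul uj uj = true  , u1
umul uj uk = false , ui
umul uk u1 = false , uk
umul uk ui = false , uj
umul uk uj = true  , ui
umul uk uk = true  , u1

Q8 : Set
Q8 = Bool × U

allQ8 : List Q8
allQ8 = concatMap (λ s → map (λ u → s , u) allU) (false ∷ true ∷ [])

mulQ : Q8 → Q8 → Q8
mulQ (s , u) (t , v) with umul u v
... | f , w = (s xor t xor f) , w

notOne : U → Bool
notOne u1 = false
notOne _  = true

invQ : Q8 → Q8
invQ (s , u) = (s xor notOne u) , u

eQ : Q8
eQ = false , u1

-- Central product of r copies of Q8 with amalgamated centres:
-- G r = Q8^r / K, K = {(z_1,…,z_r) ∈ Z(Q8)^r : z_1 ⋯ z_r = 1}.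
-- Carrier: Vec Q8 r; equality of G r is the coset relation _≈_ of K.

G : ℕ → Set
G r = Vec Q8 r

mulG : ∀ {r} → G r → G r → G r
mulG = zipWith mulQ

invG : ∀ {r} → G r → G r
invG [] = []
invG (x ∷ xs) = invQ x ∷ invG xs

eG : ∀ {r} → G r
eG = replicate _ eQ

inK : ∀ {n} → Vec Q8 n → Bool
inK v = allCentral v ∧ not (parity v)
  where
  allCentral : ∀ {n} → Vec Q8 n → Bool
  allCentral [] = true
  allCentral ((_ , u) ∷ xs) = not (notOne u) ∧ allCentral xs
  parity : ∀ {n} → Vec Q8 n → Bool
  parity [] = false
  parity ((s , _) ∷ xs) = s xor parity xs

_≈ᵇ_ : ∀ {r} → G r → G r → Bool
x ≈ᵇ y = inK (mulG x (invG y))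

_≈_ : ∀ {r} → G r → G r → Set
x ≈ y = T (x ≈ᵇ y)

-- A transversal of K in Q8^r (one representative per element of G r):
-- first coordinate arbitrary, remaining coordinates with positive sign.
posVecs : (n : ℕ) → List (Vec Q8 n)
posVecs zero = [] ∷ []
posVecs (suc n) = concatMap (λ u → map ((false , u) ∷_) (posVecs n)) allU

elems : (r : ℕ) → List (G r)
elems zero = [] ∷ []
elems (suc n) = concatMap (λ q → map (q ∷_) (posVecs n)) allQ8

count : {A : Set} → (A → Bool) → List A → ℕ
count p [] = 0
count p (x ∷ xs) = (if p x then 1 else 0) + count p xs

allL : {A : Set} → (A → Bool) → List A → Bool
allL p [] = true
allL p (x ∷ xs) = p x ∧ allL p xs

Subset : ℕ → Set
Subset r = G r → Bool

WellDefined : ∀ {r} → Subset r → Set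
WellDefined {r} X = ∀ (x y : G r) → x ≈ y → X x ≡ X y

size : ∀ {r} → Subset r → ℕ
size {r} X = count X (elems r)

inv : ∀ {r} → Subset r → Subset r
inv X g = X (invG g)

-- coefficient of g in (sum X)(sum Y) ∈ ℤG, i.e. #{(x,y) ∈ X×Y : xy = g}
coef : ∀ {r} → Subset r → Subset r → G r → ℕ
coef {r} X Y g = count (λ x → X x ∧ Y (mulG (invG x) g)) (elems r)

centre : ∀ {r} → Subset r
centre {r} g = allL (λ h → mulG g h ≈ᵇ mulG h g) (elems r)

isE : ∀ {r} → G r → Bool
isE g = g ≈ᵇ eG

ProdEqRDS : ∀ {r} → Subset r → Subset r → Subset r → ℕ → ℕ → Set
ProdEqRDS {r} N X Y k λ' =
  ∀ (g : G r) → coef X Y g ≡ (if isE g then k else 0) + (if N g then 0 else λ')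

ProdEqLinked : ∀ {r} → Subset r → Subset r → Subset r → ℕ → ℕ → Set
ProdEqLinked {r} X Y W μ ν =
  ∀ (g : G r) → coef X Y g ≡ (if W g then μ else ν)

IsRDS : ∀ {r} → Subset r → ℕ → ℕ → ℕ → ℕ → Subset r → Set
IsRDS {r} N m n k λ' X =
  ProdEqRDS N X (inv X) k λ'
  × size X ≡ k
  × size N ≡ n
  × length (elems r) ≡ m * n
  × 0 < λ'

-- |X ∩ N g| = 1 for all g  (x ∈ N g iff x g⁻¹ ∈ N)
Semiregular : ∀ {r} → Subset r → Subset r → Set
Semiregular {r} N X =
  ∀ (g : G r) → count (λ x → X x ∧ N (mulG x (invG g))) (elems r) ≡ 1

record ClosedLinkedSystem {r : ℕ} (N : Subset r) (m n k λ' s μ ν : ℕ)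
         (X : Fin s → Subset r) : Set where
  field
    two≤s    : 2 ≤ s
    welldef  : ∀ α → WellDefined (X α)
    rds      : ∀ α → IsRDS N m n k λ' (X α)
    χ        : Fin s → Fin s
    χ-bij    : Bijective _≡_ _≡_ χ
    ψ        : (α β : Fin s) → β ≢ χ α → Fin s
    inverse  : ∀ α (g : G r) → inv (X α) g ≡ X (χ α) g
    prod-χ   : ∀ α → ProdEqRDS N (X α) (X (χ α)) k λ'
    prod-ψ   : ∀ α β (p : β ≢ χ α) → ProdEqLinked (X α) (X β) (X (ψ α β p)) μ ν

-- Write an element of G as a sign and a unit vector w ∈ {1,i,j,k}^r; amalgamating the centres
-- makes the sign a single bit.  Then G/Z(G) is the Klein group (Z₂ × Z₂)^r of unit vectors, and
-- the sign of a product is twisted by a cocycle.  For α ∈ {0,1}, X α contains over every unit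
-- vector w exactly one of ±w, the sign bit being 1 + #{i : c_α(wᵢ)} mod 2 with c_0(u) = (u = 1)
-- and c_1 constantly true.  So X α meets every coset of Z(G) once, and X α⁻¹ = X (1 − α).
--
-- The number of ways to write g = x y with x ∈ X a, y ∈ X b is the number of unit vectors us
-- for which ⨁ᵢ d(usᵢ, wᵢ) has a prescribed value, where w are the units of g and d is a bit on
-- pairs of units.  This count factors over the coordinates: it obeys a linear recursion in r
-- governed by the number of units u with d(u, v) = 1.  For X α X (1 − α) that number is 0 when
-- v = 1 and 2 otherwise, which gives k e + λ (G − Z(G)); for X α X α it is 1 or 3, and the
-- recursion (ν, μ) ↦ (3ν + μ, ν + 3μ) from (1, 0) gives ν + μ = 4^r and ν − μ = 2^r.

module Submission where

open import Defs
open import Data.Nat using (ℕ; _≤_; _*_; _^_; _∸_; _+_)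
open import Data.Fin using (Fin)
open import Data.Product using (Σ; _×_)

open import Data.Bool using (Bool; true; false; _xor_; _∧_; not; if_then_else_; T)
open import Data.Bool.ListAction using (and)
open import Data.Bool.Properties
  using ( xor-assoc; xor-comm; xor-identityʳ; not-distribˡ-xor; not-involutive; xor-∧-commutativeRing
        ; ∧-assoc; ∧-idem; ∧-zeroʳ; if-float; T-∧; T-not-≡ )
open import Data.Fin using (zero; suc; opposite)
open import Data.Fin.Properties using (opposite-involutive)
open import Data.List using (List; []; _∷_; map; _++_; length; concatMap)
open import Data.List.Properties using (map-cong; map-∘; concatMap-cong; concatMap-++; map-concatMap)
open import Data.Maybe using (just; nothing)
open import Data.Nat using (zero; suc; s≤s; z≤n)
open import Data.Nat.ListAction using (sum)
open import Data.Nat.Properties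
  using (+-assoc; +-comm; +-identityʳ; +-suc; *-distribˡ-+; ^-*-assoc; m+n∸n≡m; m^n>0)
open import Data.Nat.Tactic.RingSolver using (solve-∀)
open import Data.Product using (_,_; proj₁; proj₂)
open import Data.Vec using (Vec; []; _∷_; zipWith; replicate)
import Data.Vec as Vec
open import Data.Vec.Properties using (zipWith-comm)
open import Function using (_∘_; Equivalence)
open import Function.Consequences.Propositional
  using (inverseᵇ⇒bijective; strictlyInverseˡ⇒inverseˡ; strictlyInverseʳ⇒inverseʳ)
open import Function.Definitions using (Bijective)
open import Level using (0ℓ)
open import Relation.Binary.PropositionalEquality
open import Relation.Nullary using (contradiction)
import Tactic.RingSolver as RingSolver
import Tactic.RingSolver.Core.AlmostCommutativeRing as ACR

open ≡-Reasoning

-- xor and ∧ form the field 𝔽₂, so the ring solver normalises rearrangements of xor.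
𝔽₂ : ACR.AlmostCommutativeRing 0ℓ 0ℓ
𝔽₂ = ACR.fromCommutativeRing xor-∧-commutativeRing λ { false → just refl ; true → nothing }

xor-interchange : ∀ a b c d → (a xor b) xor (c xor d) ≡ (a xor c) xor (b xor d)
xor-interchange = RingSolver.solve-∀ 𝔽₂

𝟙 : Bool → ℕ
𝟙 b = if b then 1 else 0

private variable A B : Set

count-++ : ∀ (p : A → Bool) xs ys → count p (xs ++ ys) ≡ count p xs + count p ys
count-++ p [] ys = refl
count-++ p (x ∷ xs) ys = trans (cong (𝟙 (p x) +_) (count-++ p xs ys)) (sym (+-assoc (𝟙 (p x)) _ _))

count-cong : ∀ {p q : A → Bool} → (∀ x → p x ≡ q x) → ∀ xs → count p xs ≡ count q xs
count-cong p≗q [] = refl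
count-cong p≗q (x ∷ xs) = cong₂ _+_ (cong 𝟙 (p≗q x)) (count-cong p≗q xs)

count-map : ∀ (p : B → Bool) (f : A → B) xs → count p (map f xs) ≡ count (p ∘ f) xs
count-map p f [] = refl
count-map p f (x ∷ xs) = cong (𝟙 (p (f x)) +_) (count-map p f xs)

count-concatMap : ∀ (p : B → Bool) (f : A → List B) xs →
  count p (concatMap f xs) ≡ sum (map (count p ∘ f) xs)
count-concatMap p f [] = refl
count-concatMap p f (x ∷ xs) = trans (count-++ p (f x) _) (cong (count p (f x) +_) (count-concatMap p f xs))

count-+ : ∀ {p q r : A → Bool} → (∀ x → 𝟙 (p x) + 𝟙 (q x) ≡ 𝟙 (r x)) →
  ∀ xs → count p xs + count q xs ≡ count r xs
count-+ pq≡r [] = refl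
count-+ {p = p} {q = q} {r = r} pq≡r (x ∷ xs) = begin
  (𝟙 (p x) + count p xs) + (𝟙 (q x) + count q xs)
    ≡⟨ interchange (𝟙 (p x)) (count p xs) (𝟙 (q x)) (count q xs) ⟩
  (𝟙 (p x) + 𝟙 (q x)) + (count p xs + count q xs)
    ≡⟨ cong₂ _+_ (pq≡r x) (count-+ pq≡r xs) ⟩
  𝟙 (r x) + count r xs ∎
  where
  interchange : ∀ a b c d → (a + b) + (c + d) ≡ (a + c) + (b + d)
  interchange = solve-∀

count-true : ∀ (xs : List A) → count (λ _ → true) xs ≡ length xs
count-true [] = refl
count-true (_ ∷ xs) = cong suc (count-true xs)

count-complement : ∀ (p : A → Bool) xs → count p xs + count (not ∘ p) xs ≡ length xs
count-complement p xs = trans (count-+ (λ x → 𝟙-complement (p x)) xs) (count-true xs)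
  where
  𝟙-complement : ∀ b → 𝟙 b + 𝟙 (not b) ≡ 1
  𝟙-complement false = refl
  𝟙-complement true = refl

count-const-false : ∀ (xs : List A) → count (λ _ → false) xs ≡ 0
count-const-false [] = refl
count-const-false (_ ∷ xs) = count-const-false xs

count-∧ˡ : ∀ b (p : A → Bool) xs → count (λ x → b ∧ p x) xs ≡ (if b then count p xs else 0)
count-∧ˡ false p xs = count-const-false xs
count-∧ˡ true p xs = refl

sum-map-xor : ∀ (k : Bool → ℕ) β (c : A → Bool) xs →
  sum (map (λ x → k (β xor c x)) xs) ≡ count (not ∘ c) xs * k β + count c xs * k (not β)
sum-map-xor k β c [] = refl
sum-map-xor k β c (x ∷ xs) with c x
... | false = begin
  k (β xor false) + sum (map (λ x → k (β xor c x)) xs)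
    ≡⟨ cong₂ _+_ (cong k (xor-identityʳ β)) (sum-map-xor k β c xs) ⟩
  k β + (count (not ∘ c) xs * k β + count c xs * k (not β))
    ≡⟨ +-assoc (k β) (count (not ∘ c) xs * k β) (count c xs * k (not β)) ⟨
  (k β + count (not ∘ c) xs * k β) + count c xs * k (not β) ∎
... | true = begin
  k (β xor true) + sum (map (λ x → k (β xor c x)) xs)
    ≡⟨ cong₂ _+_ (cong k (xor-comm β true)) (sum-map-xor k β c xs) ⟩
  k (not β) + (count (not ∘ c) xs * k β + count c xs * k (not β))
    ≡⟨ left-comm (k (not β)) (count (not ∘ c) xs * k β) (count c xs * k (not β)) ⟩
  count (not ∘ c) xs * k β + (k (not β) + count c xs * k (not β)) ∎
  where
  left-comm : ∀ a b c → a + (b + c) ≡ b + (a + c)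
  left-comm = solve-∀

allL-++ : ∀ (p : A → Bool) xs ys → allL p (xs ++ ys) ≡ allL p xs ∧ allL p ys
allL-++ p [] ys = refl
allL-++ p (x ∷ xs) ys = trans (cong (p x ∧_) (allL-++ p xs ys)) (sym (∧-assoc (p x) _ _))

allL-cong : ∀ {p q : A → Bool} → (∀ x → p x ≡ q x) → ∀ xs → allL p xs ≡ allL q xs
allL-cong p≗q [] = refl
allL-cong p≗q (x ∷ xs) = cong₂ _∧_ (p≗q x) (allL-cong p≗q xs)

allL-map : ∀ (p : B → Bool) (f : A → B) xs → allL p (map f xs) ≡ allL (p ∘ f) xs
allL-map p f [] = refl
allL-map p f (x ∷ xs) = cong (p (f x) ∧_) (allL-map p f xs)

allL-concatMap : ∀ (p : B → Bool) (f : A → List B) xs →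
  allL p (concatMap f xs) ≡ and (map (allL p ∘ f) xs)
allL-concatMap p f [] = refl
allL-concatMap p f (x ∷ xs) = trans (allL-++ p (f x) _) (cong (allL p (f x) ∧_) (allL-concatMap p f xs))

mulU : U → U → U
mulU u v = proj₂ (umul u v)

signU : U → U → Bool
signU u v = proj₁ (umul u v)

isOne : U → Bool
isOne u = not (notOne u)

sign : ∀ {n} → Vec Q8 n → Bool
sign [] = false
sign ((s , _) ∷ xs) = s xor sign xs

units : ∀ {n} → Vec Q8 n → Vec U n
units = Vec.map proj₂

⨁ : (U → Bool) → ∀ {n} → Vec U n → Bool
⨁ f [] = false
⨁ f (u ∷ us) = f u xor ⨁ f us

⨁₂ : (U → U → Bool) → ∀ {n} → Vec U n → Vec U n → Bool
⨁₂ d [] [] = false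
⨁₂ d (u ∷ us) (v ∷ vs) = d u v xor ⨁₂ d us vs

allOne : ∀ {n} → Vec U n → Bool
allOne [] = true
allOne (u ∷ us) = isOne u ∧ allOne us

ones : ∀ n → Vec U n
ones n = replicate n u1

⨁-xor : ∀ (f h : U → Bool) {n} (w : Vec U n) → ⨁ f w xor ⨁ h w ≡ ⨁ (λ u → f u xor h u) w
⨁-xor f h [] = refl
⨁-xor f h (u ∷ w) = trans (xor-interchange (f u) (⨁ f w) (h u) (⨁ h w)) (cong ((f u xor h u) xor_) (⨁-xor f h w))

⨁-cong : ∀ {f h : U → Bool} → (∀ u → f u ≡ h u) → ∀ {n} (w : Vec U n) → ⨁ f w ≡ ⨁ h w
⨁-cong f≗h [] = refl
⨁-cong f≗h (u ∷ w) = cong₂ _xor_ (f≗h u) (⨁-cong f≗h w)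

mulQ-split : ∀ s u t v → mulQ (s , u) (t , v) ≡ (s xor t xor signU u v , mulU u v)
mulQ-split s u t v with umul u v
... | _ , _ = refl

units-mul : ∀ {n} (a b : G n) → units (mulG a b) ≡ zipWith mulU (units a) (units b)
units-mul [] [] = refl
units-mul ((s , u) ∷ a) ((t , v) ∷ b) = cong₂ _∷_ (cong proj₂ (mulQ-split s u t v)) (units-mul a b)

sign-mul : ∀ {n} (a b : G n) →
  sign (mulG a b) ≡ sign a xor sign b xor ⨁₂ signU (units a) (units b)
sign-mul [] [] = refl
sign-mul ((s , u) ∷ a) ((t , v) ∷ b) = begin
  proj₁ (mulQ (s , u) (t , v)) xor sign (mulG a b)
    ≡⟨ cong₂ _xor_ (cong proj₁ (mulQ-split s u t v)) (sign-mul a b) ⟩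
  (s xor t xor c) xor (sign a xor sign b xor C)
    ≡⟨ xor-interchange s (t xor c) (sign a) (sign b xor C) ⟩
  (s xor sign a) xor ((t xor c) xor (sign b xor C))
    ≡⟨ cong ((s xor sign a) xor_) (xor-interchange t c (sign b) C) ⟩
  (s xor sign a) xor (t xor sign b) xor (c xor C) ∎
  where
  c = signU u v
  C = ⨁₂ signU (units a) (units b)

units-inv : ∀ {n} (a : G n) → units (invG a) ≡ units a
units-inv [] = refl
units-inv (_ ∷ a) = cong (_ ∷_) (units-inv a)

sign-inv : ∀ {n} (a : G n) → sign (invG a) ≡ sign a xor ⨁ notOne (units a)
sign-inv [] = refl
sign-inv ((s , u) ∷ a) = begin
  (s xor notOne u) xor sign (invG a)  ≡⟨ cong ((s xor notOne u) xor_) (sign-inv a) ⟩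
  (s xor notOne u) xor (sign a xor N) ≡⟨ xor-interchange s (notOne u) (sign a) N ⟩
  (s xor sign a) xor (notOne u xor N) ∎
  where
  N = ⨁ notOne (units a)

-- The helper functions of inK are local to its where-block; unification recovers their values.
inK-∷ : ∀ {n} s u (xs : Vec Q8 n) →
  Σ (Bool × Bool) λ (c , p) → inK ((s , u) ∷ xs) ≡ (isOne u ∧ c) ∧ not (s xor p)
inK-∷ s u xs = _ , refl

private
  inK-central inK-parity : ∀ {n} → Vec Q8 n → Bool
  inK-central xs = proj₁ (proj₁ (inK-∷ false u1 xs))
  inK-parity xs = proj₂ (proj₁ (inK-∷ false u1 xs))

  inK-central-allOne : ∀ {n} (v : Vec Q8 n) → inK-central v ≡ allOne (units v)
  inK-central-allOne [] = refl
  inK-central-allOne ((_ , u) ∷ xs) = cong (isOne u ∧_) (inK-central-allOne xs)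

  inK-parity-sign : ∀ {n} (v : Vec Q8 n) → inK-parity v ≡ sign v
  inK-parity-sign [] = refl
  inK-parity-sign ((s , _) ∷ xs) = cong (s xor_) (inK-parity-sign xs)

inK-split : ∀ {n} (v : Vec Q8 n) → inK v ≡ allOne (units v) ∧ not (sign v)
inK-split v = cong₂ (λ c p → c ∧ not p) (inK-central-allOne v) (inK-parity-sign v)

≈ᵇ-split : ∀ {n} (x y : G n) → (x ≈ᵇ y) ≡
  allOne (zipWith mulU (units x) (units y))
    ∧ not (sign x xor (sign y xor ⨁ notOne (units y)) xor ⨁₂ signU (units x) (units y))
≈ᵇ-split x y = begin
  inK (mulG x (invG y))
    ≡⟨ inK-split (mulG x (invG y)) ⟩
  allOne (units (mulG x (invG y))) ∧ not (sign (mulG x (invG y)))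
    ≡⟨ cong₂ (λ w s → allOne w ∧ not s)
         (trans (units-mul x (invG y)) (cong (zipWith mulU (units x)) (units-inv y)))
         (trans (sign-mul x (invG y))
           (cong₂ (λ s w → sign x xor s xor ⨁₂ signU (units x) w) (sign-inv y) (units-inv y))) ⟩
  _ ∎

mulQ-identityʳ : ∀ x → mulQ x eQ ≡ x
mulQ-identityʳ (s , u1) = cong (_, u1) (xor-identityʳ s)
mulQ-identityʳ (s , ui) = cong (_, ui) (xor-identityʳ s)
mulQ-identityʳ (s , uj) = cong (_, uj) (xor-identityʳ s)
mulQ-identityʳ (s , uk) = cong (_, uk) (xor-identityʳ s)

mulG-identityʳ : ∀ {n} (g : G n) → mulG g eG ≡ g
mulG-identityʳ [] = refl
mulG-identityʳ (x ∷ g) = cong₂ _∷_ (mulQ-identityʳ x) (mulG-identityʳ g)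

invG-identity : ∀ n → invG (eG {n}) ≡ eG
invG-identity zero = refl
invG-identity (suc n) = cong (eQ ∷_) (invG-identity n)

isE-split : ∀ {n} (g : G n) → isE g ≡ allOne (units g) ∧ not (sign g)
isE-split {n} g = begin
  inK (mulG g (invG eG)) ≡⟨ cong (λ h → inK (mulG g h)) (invG-identity n) ⟩
  inK (mulG g eG)        ≡⟨ cong inK (mulG-identityʳ g) ⟩
  inK g                  ≡⟨ inK-split g ⟩
  allOne (units g) ∧ not (sign g) ∎

-- The units form the Klein four-group

mulU-comm : ∀ u v → mulU u v ≡ mulU v u
mulU-comm u1 u1 = refl
mulU-comm u1 ui = refl
mulU-comm u1 uj = refl
mulU-comm u1 uk = refl
mulU-comm ui u1 = refl
mulU-comm ui ui = refl
mulU-comm ui uj = refl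
mulU-comm ui uk = refl
mulU-comm uj u1 = refl
mulU-comm uj ui = refl
mulU-comm uj uj = refl
mulU-comm uj uk = refl
mulU-comm uk u1 = refl
mulU-comm uk ui = refl
mulU-comm uk uj = refl
mulU-comm uk uk = refl

isOne-mulU⇒≡ : ∀ u v → T (isOne (mulU u v)) → u ≡ v
isOne-mulU⇒≡ u1 u1 _ = refl
isOne-mulU⇒≡ ui ui _ = refl
isOne-mulU⇒≡ uj uj _ = refl
isOne-mulU⇒≡ uk uk _ = refl
isOne-mulU⇒≡ u1 ui ()
isOne-mulU⇒≡ u1 uj ()
isOne-mulU⇒≡ u1 uk ()
isOne-mulU⇒≡ ui u1 ()
isOne-mulU⇒≡ ui uj ()
isOne-mulU⇒≡ ui uk ()
isOne-mulU⇒≡ uj u1 ()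
isOne-mulU⇒≡ uj ui ()
isOne-mulU⇒≡ uj uk ()
isOne-mulU⇒≡ uk u1 ()
isOne-mulU⇒≡ uk ui ()
isOne-mulU⇒≡ uk uj ()

isOne-mulU-self : ∀ u → isOne (mulU u u) ≡ true
isOne-mulU-self u1 = refl
isOne-mulU-self ui = refl
isOne-mulU-self uj = refl
isOne-mulU-self uk = refl

signU-self : ∀ u → signU u u ≡ notOne u
signU-self u1 = refl
signU-self ui = refl
signU-self uj = refl
signU-self uk = refl

mulU-identityʳ : ∀ u → mulU u u1 ≡ u
mulU-identityʳ u1 = refl
mulU-identityʳ ui = refl
mulU-identityʳ uj = refl
mulU-identityʳ uk = refl

allOne-mulU⇒≡ : ∀ {n} (a b : Vec U n) → T (allOne (zipWith mulU a b)) → a ≡ b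
allOne-mulU⇒≡ [] [] _ = refl
allOne-mulU⇒≡ (u ∷ a) (v ∷ b) h with Equivalence.to T-∧ h
... | hu , ha = cong₂ _∷_ (isOne-mulU⇒≡ u v hu) (allOne-mulU⇒≡ a b ha)

allOne-mulU-self : ∀ {n} (a : Vec U n) → allOne (zipWith mulU a a) ≡ true
allOne-mulU-self [] = refl
allOne-mulU-self (u ∷ a) = cong₂ _∧_ (isOne-mulU-self u) (allOne-mulU-self a)

⨁₂-signU-self : ∀ {n} (a : Vec U n) → ⨁₂ signU a a ≡ ⨁ notOne a
⨁₂-signU-self [] = refl
⨁₂-signU-self (u ∷ a) = cong₂ _xor_ (signU-self u) (⨁₂-signU-self a)

zipWith-mulU-ones : ∀ {n} (us : Vec U n) → zipWith mulU us (ones n) ≡ us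
zipWith-mulU-ones [] = refl
zipWith-mulU-ones (u ∷ us) = cong₂ _∷_ (mulU-identityʳ u) (zipWith-mulU-ones us)

xor≡false⇒≡ : ∀ a b → a xor b ≡ false → a ≡ b
xor≡false⇒≡ false false _ = refl
xor≡false⇒≡ true true _ = refl

≈⇒coords : ∀ {n} {x y : G n} → x ≈ y → units x ≡ units y × sign x ≡ sign y
≈⇒coords {x = x} {y} x≈y with Equivalence.to T-∧ (subst T (≈ᵇ-split x y) x≈y)
... | same-units , same-sign = units≡ , xor≡false⇒≡ (sign x) (sign y) sign-xor
  where
  units≡ = allOne-mulU⇒≡ (units x) (units y) same-units
  N = ⨁ notOne (units y)
  cancel : ∀ a b N → a xor (b xor N) xor N ≡ a xor b
  cancel = RingSolver.solve-∀ 𝔽₂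
  sign-xor : sign x xor sign y ≡ false
  sign-xor = begin
    sign x xor sign y
      ≡⟨ cancel (sign x) (sign y) N ⟨
    sign x xor (sign y xor N) xor N
      ≡⟨ cong (λ w → sign x xor (sign y xor N) xor w)
           (trans (cong (λ w → ⨁₂ signU w (units y)) units≡) (⨁₂-signU-self (units y))) ⟨
    sign x xor (sign y xor N) xor ⨁₂ signU (units x) (units y)
      ≡⟨ Equivalence.to T-not-≡ same-sign ⟩
    false ∎

anticommU : U → U → Bool
anticommU u v = signU u v xor signU v u

⨁₂-anticommU : ∀ {n} (a b : Vec U n) → ⨁₂ signU a b xor ⨁₂ signU b a ≡ ⨁₂ anticommU a b
⨁₂-anticommU [] [] = refl
⨁₂-anticommU (u ∷ a) (v ∷ b) = begin
  (signU u v xor ⨁₂ signU a b) xor (signU v u xor ⨁₂ signU b a)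
    ≡⟨ xor-interchange (signU u v) (⨁₂ signU a b) (signU v u) (⨁₂ signU b a) ⟩
  anticommU u v xor (⨁₂ signU a b xor ⨁₂ signU b a)
    ≡⟨ cong (anticommU u v xor_) (⨁₂-anticommU a b) ⟩
  anticommU u v xor ⨁₂ anticommU a b ∎

≈ᵇ-commutator : ∀ {n} (g h : G n) → (mulG g h ≈ᵇ mulG h g) ≡ not (⨁₂ anticommU (units g) (units h))
≈ᵇ-commutator g h
  rewrite ≈ᵇ-split (mulG g h) (mulG h g) | units-mul g h | units-mul h g
        | zipWith-comm mulU-comm (units h) (units g)
        | allOne-mulU-self (zipWith mulU (units g) (units h))
        | ⨁₂-signU-self (zipWith mulU (units g) (units h))
        | sign-mul g h | sign-mul h g
  = cong not (trans (cancel (sign g) (sign h) _ _ _) (⨁₂-anticommU (units g) (units h)))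
  where
  cancel : ∀ s t C D N → (s xor t xor C) xor ((t xor s xor D) xor N) xor N ≡ C xor D
  cancel = RingSolver.solve-∀ 𝔽₂

uvecs : (n : ℕ) → List (Vec U n)
uvecs zero = [] ∷ []
uvecs (suc n) = concatMap (λ u → map (u ∷_) (uvecs n)) allU

positive : ∀ {n} → Vec U n → Vec Q8 n
positive = Vec.map (false ,_)

rep : ∀ {n} → Bool → Vec U (suc n) → G (suc n)
rep b (u ∷ us) = (b , u) ∷ positive us

sign-positive : ∀ {n} (us : Vec U n) → sign (positive us) ≡ false
sign-positive [] = refl
sign-positive (_ ∷ us) = sign-positive us

units-positive : ∀ {n} (us : Vec U n) → units (positive us) ≡ us
units-positive [] = refl
units-positive (u ∷ us) = cong (u ∷_) (units-positive us)

sign-rep : ∀ {n} b (us : Vec U (suc n)) → sign (rep b us) ≡ b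
sign-rep b (_ ∷ us) = trans (cong (b xor_) (sign-positive us)) (xor-identityʳ b)

units-rep : ∀ {n} b (us : Vec U (suc n)) → units (rep b us) ≡ us
units-rep b (u ∷ us) = cong (u ∷_) (units-positive us)

mutual
  posVecs-≡ : ∀ n → posVecs n ≡ map positive (uvecs n)
  posVecs-≡ zero = refl
  posVecs-≡ (suc n) = trans (posVecs-block false n) (map-cong (λ { (_ ∷ _) → refl }) (uvecs (suc n)))

  posVecs-block : ∀ b n →
    concatMap (λ u → map ((b , u) ∷_) (posVecs n)) allU ≡ map (rep b) (uvecs (suc n))
  posVecs-block b n = begin
    concatMap (λ u → map ((b , u) ∷_) (posVecs n)) allU
      ≡⟨ concatMap-cong (λ u → cong (map ((b , u) ∷_)) (posVecs-≡ n)) allU ⟩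
    concatMap (λ u → map ((b , u) ∷_) (map positive (uvecs n))) allU
      ≡⟨ concatMap-cong (λ u →
           trans (sym (map-∘ {g = (b , u) ∷_} {f = positive} (uvecs n)))
                 (map-∘ {g = rep b} {f = u ∷_} (uvecs n))) allU ⟩
    concatMap (λ u → map (rep b) (map (u ∷_) (uvecs n))) allU
      ≡⟨ map-concatMap (rep b) (λ u → map (u ∷_) (uvecs n)) allU ⟨
    map (rep b) (uvecs (suc n)) ∎

elems-≡ : ∀ n → elems (suc n) ≡ map (rep false) (uvecs (suc n)) ++ map (rep true) (uvecs (suc n))
elems-≡ n = begin
  elems (suc n)
    ≡⟨ concatMap-++ row (map (false ,_) allU) (map (true ,_) allU) ⟩
  concatMap row (map (false ,_) allU) ++ concatMap row (map (true ,_) allU)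
    ≡⟨ cong₂ _++_ (posVecs-block false n) (posVecs-block true n) ⟩
  map (rep false) (uvecs (suc n)) ++ map (rep true) (uvecs (suc n)) ∎
  where
  row : Q8 → List (G (suc n))
  row q = map (q ∷_) (posVecs n)

count-elems : ∀ n (P : Bool → Vec U (suc n) → Bool) {p : G (suc n) → Bool} →
  (∀ x → p x ≡ P (sign x) (units x)) →
  count p (elems (suc n)) ≡ count (P false) (uvecs (suc n)) + count (P true) (uvecs (suc n))
count-elems n P {p} p≡P = begin
  count p (elems (suc n))
    ≡⟨ cong (count p) (elems-≡ n) ⟩
  count p (map (rep false) (uvecs (suc n)) ++ map (rep true) (uvecs (suc n)))
    ≡⟨ count-++ p (map (rep false) (uvecs (suc n))) (map (rep true) (uvecs (suc n))) ⟩
  count p (map (rep false) (uvecs (suc n))) + count p (map (rep true) (uvecs (suc n)))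
    ≡⟨ cong₂ _+_ (on false) (on true) ⟩
  count (P false) (uvecs (suc n)) + count (P true) (uvecs (suc n)) ∎
  where
  on : ∀ b → count p (map (rep b) (uvecs (suc n))) ≡ count (P b) (uvecs (suc n))
  on b = trans (count-map p (rep b) (uvecs (suc n)))
    (count-cong (λ us → trans (p≡P (rep b us)) (cong₂ P (sign-rep b us) (units-rep b us))) (uvecs (suc n)))

allL-elems : ∀ n (P : Bool → Vec U (suc n) → Bool) {p : G (suc n) → Bool} →
  (∀ x → p x ≡ P (sign x) (units x)) →
  allL p (elems (suc n)) ≡ allL (P false) (uvecs (suc n)) ∧ allL (P true) (uvecs (suc n))
allL-elems n P {p} p≡P = begin
  allL p (elems (suc n))
    ≡⟨ cong (allL p) (elems-≡ n) ⟩
  allL p (map (rep false) (uvecs (suc n)) ++ map (rep true) (uvecs (suc n)))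
    ≡⟨ allL-++ p (map (rep false) (uvecs (suc n))) (map (rep true) (uvecs (suc n))) ⟩
  allL p (map (rep false) (uvecs (suc n))) ∧ allL p (map (rep true) (uvecs (suc n)))
    ≡⟨ cong₂ _∧_ (on false) (on true) ⟩
  allL (P false) (uvecs (suc n)) ∧ allL (P true) (uvecs (suc n)) ∎
  where
  on : ∀ b → allL p (map (rep b) (uvecs (suc n))) ≡ allL (P b) (uvecs (suc n))
  on b = trans (allL-map p (rep b) (uvecs (suc n)))
    (allL-cong (λ us → trans (p≡P (rep b us)) (cong₂ P (sign-rep b us) (units-rep b us))) (uvecs (suc n)))

Σᵤ : (U → ℕ) → ℕ
Σᵤ f = sum (map f allU)

⋀ᵤ : (U → Bool) → Bool
⋀ᵤ f = and (map f allU)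

count-uvecs : ∀ n (p : Vec U (suc n) → Bool) →
  count p (uvecs (suc n)) ≡ Σᵤ (λ u → count (p ∘ (u ∷_)) (uvecs n))
count-uvecs n p = trans (count-concatMap p (λ u → map (u ∷_) (uvecs n)) allU)
  (cong sum (map-cong (λ u → count-map p (u ∷_) (uvecs n)) allU))

allL-uvecs : ∀ n (p : Vec U (suc n) → Bool) →
  allL p (uvecs (suc n)) ≡ ⋀ᵤ (λ u → allL (p ∘ (u ∷_)) (uvecs n))
allL-uvecs n p = trans (allL-concatMap p (λ u → map (u ∷_) (uvecs n)) allU)
  (cong and (map-cong (λ u → allL-map p (u ∷_) (uvecs n)) allU))

length-uvecs : ∀ n → length (uvecs n) ≡ 4 ^ n
length-uvecs zero = refl
length-uvecs (suc n) = begin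
  length (uvecs (suc n))                              ≡⟨ count-true (uvecs (suc n)) ⟨
  count (λ _ → true) (uvecs (suc n))                  ≡⟨ count-uvecs n (λ _ → true) ⟩
  Σᵤ (λ _ → count (λ _ → true) (uvecs n))             ≡⟨ cong (λ c → Σᵤ (λ _ → c)) (trans (count-true (uvecs n)) (length-uvecs n)) ⟩
  Σᵤ (λ _ → 4 ^ n)                                    ≡⟨ four-times (4 ^ n) ⟩
  4 ^ suc n ∎
  where
  four-times : ∀ a → a + (a + (a + (a + 0))) ≡ 4 * a
  four-times = solve-∀

count-mulU-allOne : ∀ n (w : Vec U n) → count (λ us → allOne (zipWith mulU us w)) (uvecs n) ≡ 1
count-mulU-allOne zero [] = refl
count-mulU-allOne (suc n) (v ∷ w) = begin
  count (λ us → allOne (zipWith mulU us (v ∷ w))) (uvecs (suc n))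
    ≡⟨ count-uvecs n _ ⟩
  Σᵤ (λ u → count (λ us → isOne (mulU u v) ∧ allOne (zipWith mulU us w)) (uvecs n))
    ≡⟨ cong sum (map-cong column allU) ⟩
  Σᵤ (λ u → 𝟙 (isOne (mulU u v)))
    ≡⟨ exactly-one v ⟩
  1 ∎
  where
  column : ∀ u → count (λ us → isOne (mulU u v) ∧ allOne (zipWith mulU us w)) (uvecs n) ≡ 𝟙 (isOne (mulU u v))
  column u = trans (count-∧ˡ (isOne (mulU u v)) _ (uvecs n))
    (cong (λ c → if isOne (mulU u v) then c else 0) (count-mulU-allOne n w))
  exactly-one : ∀ v → Σᵤ (λ u → 𝟙 (isOne (mulU u v))) ≡ 1
  exactly-one u1 = refl
  exactly-one ui = refl
  exactly-one uj = refl
  exactly-one uk = refl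

count-allOne : ∀ n → count allOne (uvecs n) ≡ 1
count-allOne n = trans (count-cong (λ us → cong allOne (sym (zipWith-mulU-ones us))) (uvecs n))
  (count-mulU-allOne n (ones n))

4^≡2^2* : ∀ n → 4 ^ n ≡ 2 ^ (2 * n)
4^≡2^2* = ^-*-assoc 2 2

length-elems : ∀ n → length (elems (suc n)) ≡ 2 ^ (2 * suc n) * 2
length-elems n = begin
  length (elems (suc n))
    ≡⟨ count-true (elems (suc n)) ⟨
  count (λ _ → true) (elems (suc n))
    ≡⟨ count-elems n (λ _ _ → true) (λ _ → refl) ⟩
  count (λ _ → true) (uvecs (suc n)) + count (λ _ → true) (uvecs (suc n))
    ≡⟨ cong (λ c → c + c) (trans (count-true (uvecs (suc n))) (length-uvecs (suc n))) ⟩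
  4 ^ suc n + 4 ^ suc n
    ≡⟨ cong (λ c → c + c) (4^≡2^2* (suc n)) ⟩
  2 ^ (2 * suc n) + 2 ^ (2 * suc n)
    ≡⟨ double (2 ^ (2 * suc n)) ⟩
  2 ^ (2 * suc n) * 2 ∎
  where
  double : ∀ a → a + a ≡ a * 2
  double = solve-∀

-- The centre

⋀ᵤ-false : ∀ f u → f u ≡ false → ⋀ᵤ f ≡ false
⋀ᵤ-false f u1 h rewrite h = refl
⋀ᵤ-false f ui h rewrite h = ∧-zeroʳ (f u1)
⋀ᵤ-false f uj h rewrite h = trans (cong (f u1 ∧_) (∧-zeroʳ (f ui))) (∧-zeroʳ (f u1))
⋀ᵤ-false f uk h rewrite h =
  trans (cong (λ b → f u1 ∧ (f ui ∧ b)) (∧-zeroʳ (f uj))) (trans (cong (f u1 ∧_) (∧-zeroʳ (f ui))) (∧-zeroʳ (f u1)))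

allL-uvecs-ones : ∀ n (p : Vec U n → Bool) → p (ones n) ≡ false → allL p (uvecs n) ≡ false
allL-uvecs-ones zero p h = cong (_∧ true) h
allL-uvecs-ones (suc n) p h =
  trans (allL-uvecs n p) (⋀ᵤ-false (λ u → allL (p ∘ (u ∷_)) (uvecs n)) u1 (allL-uvecs-ones n (p ∘ (u1 ∷_)) h))

⨁₂-anticommU-ones : ∀ {n} (w : Vec U n) → ⨁₂ anticommU w (ones n) ≡ false
⨁₂-anticommU-ones [] = refl
⨁₂-anticommU-ones (u1 ∷ w) = ⨁₂-anticommU-ones w
⨁₂-anticommU-ones (ui ∷ w) = ⨁₂-anticommU-ones w
⨁₂-anticommU-ones (uj ∷ w) = ⨁₂-anticommU-ones w
⨁₂-anticommU-ones (uk ∷ w) = ⨁₂-anticommU-ones w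

-- A unit v ≠ 1 anticommutes with some unit, while the all-ones vector commutes with every w.
allOne-commuting : ∀ n (w : Vec U n) → allL (λ us → not (⨁₂ anticommU w us)) (uvecs n) ≡ allOne w
allOne-commuting zero [] = refl
allOne-commuting (suc n) (v ∷ w) =
  trans (allL-uvecs n (λ us → not (⨁₂ anticommU (v ∷ w) us))) (by-cases v)
  where
  anticommuting-false : allL (λ us → not (true xor ⨁₂ anticommU w us)) (uvecs n) ≡ false
  anticommuting-false = allL-uvecs-ones n _ (cong (not ∘ not) (⨁₂-anticommU-ones w))
  all-four : ∀ a → a ∧ (a ∧ (a ∧ (a ∧ true))) ≡ a
  all-four false = refl
  all-four true = refl
  column : U → U → Bool
  column v u = allL (λ us → not (anticommU v u xor ⨁₂ anticommU w us)) (uvecs n)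
  by-cases : ∀ v → ⋀ᵤ (column v) ≡ allOne (v ∷ w)
  by-cases u1 = trans (all-four _) (allOne-commuting n w)
  by-cases ui = ⋀ᵤ-false (column ui) uj anticommuting-false
  by-cases uj = ⋀ᵤ-false (column uj) uk anticommuting-false
  by-cases uk = ⋀ᵤ-false (column uk) ui anticommuting-false

centre-units : ∀ n (g : G (suc n)) → centre g ≡ allOne (units g)
centre-units n g = begin
  centre g
    ≡⟨ allL-elems n (λ _ us → commuting us) (≈ᵇ-commutator g) ⟩
  allL commuting (uvecs (suc n)) ∧ allL commuting (uvecs (suc n))
    ≡⟨ ∧-idem _ ⟩
  allL commuting (uvecs (suc n))
    ≡⟨ allOne-commuting (suc n) (units g) ⟩
  allOne (units g) ∎
  where
  commuting : Vec U (suc n) → Bool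
  commuting us = not (⨁₂ anticommU (units g) us)

size-centre : ∀ n → size {suc n} centre ≡ 2
size-centre n = trans (count-elems n (λ _ → allOne) (centre-units n))
  (cong₂ _+_ (count-allOne (suc n)) (count-allOne (suc n)))

-- The sets X α

choice : Fin 2 → U → Bool
choice zero u = isOne u
choice (suc zero) _ = true

X : ∀ {r} → Fin 2 → Subset r
X α g = sign g xor ⨁ (choice α) (units g)

X-welldefined : ∀ {r} α → WellDefined {r} (X α)
X-welldefined α x y x≈y = cong₂ (λ s w → s xor ⨁ (choice α) w) same-sign same-units
  where
  same-units = proj₁ (≈⇒coords {x = x} {y} x≈y)
  same-sign = proj₂ (≈⇒coords {x = x} {y} x≈y)

choice-opposite : ∀ α u → notOne u xor choice α u ≡ choice (opposite α) u
choice-opposite zero u1 = refl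
choice-opposite zero ui = refl
choice-opposite zero uj = refl
choice-opposite zero uk = refl
choice-opposite (suc zero) u1 = refl
choice-opposite (suc zero) ui = refl
choice-opposite (suc zero) uj = refl
choice-opposite (suc zero) uk = refl

X-inv : ∀ {r} α (g : G r) → inv (X α) g ≡ X (opposite α) g
X-inv α g = begin
  sign (invG g) xor ⨁ (choice α) (units (invG g))
    ≡⟨ cong₂ (λ s w → s xor ⨁ (choice α) w) (sign-inv g) (units-inv g) ⟩
  (sign g xor ⨁ notOne (units g)) xor ⨁ (choice α) (units g)
    ≡⟨ xor-assoc (sign g) _ _ ⟩
  sign g xor (⨁ notOne (units g) xor ⨁ (choice α) (units g))
    ≡⟨ cong (sign g xor_) (trans (⨁-xor notOne (choice α) (units g)) (⨁-cong (choice-opposite α) (units g))) ⟩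
  sign g xor ⨁ (choice (opposite α)) (units g) ∎

X-semiregular : ∀ n α → Semiregular {suc n} centre (X α)
X-semiregular n α g = begin
  count (λ x → X α x ∧ centre (mulG x (invG g))) (elems (suc n))
    ≡⟨ count-elems n P coords ⟩
  count (P false) (uvecs (suc n)) + count (P true) (uvecs (suc n))
    ≡⟨ count-+ (λ us → one-lift (⨁ (choice α) us) (allOne (zipWith mulU us (units g)))) (uvecs (suc n)) ⟩
  count (λ us → allOne (zipWith mulU us (units g))) (uvecs (suc n))
    ≡⟨ count-mulU-allOne (suc n) (units g) ⟩
  1 ∎
  where
  P : Bool → Vec U (suc n) → Bool
  P c us = (c xor ⨁ (choice α) us) ∧ allOne (zipWith mulU us (units g))
  coords : ∀ x → X α x ∧ centre (mulG x (invG g)) ≡ P (sign x) (units x)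
  coords x = cong (X α x ∧_) (begin
    centre (mulG x (invG g))                             ≡⟨ centre-units n (mulG x (invG g)) ⟩
    allOne (units (mulG x (invG g)))                     ≡⟨ cong allOne (units-mul x (invG g)) ⟩
    allOne (zipWith mulU (units x) (units (invG g)))     ≡⟨ cong (allOne ∘ zipWith mulU (units x)) (units-inv g) ⟩
    allOne (zipWith mulU (units x) (units g)) ∎)
  one-lift : ∀ a c → 𝟙 ((false xor a) ∧ c) + 𝟙 ((true xor a) ∧ c) ≡ 𝟙 c
  one-lift false c = refl
  one-lift true c = +-identityʳ (𝟙 c)

size-X : ∀ n α → size {suc n} (X α) ≡ 2 ^ (2 * suc n)
size-X n α = begin
  count (X α) (elems (suc n))
    ≡⟨ count-elems n (λ c us → c xor ⨁ (choice α) us) (λ _ → refl) ⟩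
  count (⨁ (choice α)) (uvecs (suc n)) + count (not ∘ ⨁ (choice α)) (uvecs (suc n))
    ≡⟨ count-complement (⨁ (choice α)) (uvecs (suc n)) ⟩
  length (uvecs (suc n))
    ≡⟨ trans (length-uvecs (suc n)) (4^≡2^2* (suc n)) ⟩
  2 ^ (2 * suc n) ∎

productBit : Fin 2 → Fin 2 → U → U → Bool
productBit a b u v = choice a u xor (notOne u xor (signU u v xor choice b (mulU u v)))

xorCount : (U → U → Bool) → Bool → ∀ {n} → Vec U n → ℕ
xorCount d β {n} w = count (λ us → β xor ⨁₂ d us w) (uvecs n)

⨁₂-productBit : ∀ a b {n} (us w : Vec U n) →
  ⨁ (choice a) us xor (⨁ notOne us xor (⨁₂ signU us w xor ⨁ (choice b) (zipWith mulU us w)))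
    ≡ ⨁₂ (productBit a b) us w
⨁₂-productBit a b [] [] = refl
⨁₂-productBit a b (u ∷ us) (v ∷ w) =
  trans (interchange (choice a u) (⨁ (choice a) us) (notOne u) (⨁ notOne us)
                     (signU u v) (⨁₂ signU us w) (choice b (mulU u v)) (⨁ (choice b) (zipWith mulU us w)))
        (cong (productBit a b u v xor_) (⨁₂-productBit a b us w))
  where
  interchange : ∀ a A n N c C f F →
    (a xor A) xor ((n xor N) xor ((c xor C) xor (f xor F)))
      ≡ (a xor (n xor (c xor f))) xor (A xor (N xor (C xor F)))
  interchange = RingSolver.solve-∀ 𝔽₂

X-inverse-product : ∀ {r} b (x g : G r) →
  X b (mulG (invG x) g)
    ≡ sign x xor (sign g xor (⨁ notOne (units x) xor (⨁₂ signU (units x) (units g)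
                   xor ⨁ (choice b) (zipWith mulU (units x) (units g)))))
X-inverse-product b x g
  rewrite sign-mul (invG x) g | units-mul (invG x) g | sign-inv x | units-inv x
  = rearrange (sign x) _ (sign g) _ _
  where
  rearrange : ∀ s N t C F → ((s xor N) xor t xor C) xor F ≡ s xor (t xor (N xor (C xor F)))
  rearrange = RingSolver.solve-∀ 𝔽₂

coef-xorCount : ∀ n a b (g : G (suc n)) →
  coef (X a) (X b) g ≡ xorCount (productBit a b) (not (sign g)) (units g)
coef-xorCount n a b g = begin
  coef (X a) (X b) g
    ≡⟨ count-elems n P coords ⟩
  count (P false) (uvecs (suc n)) + count (P true) (uvecs (suc n))
    ≡⟨ count-+ (λ us → 𝟙-agree (Φa us) (Φb us)) (uvecs (suc n)) ⟩
  count (λ us → not (Φa us xor Φb us)) (uvecs (suc n))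
    ≡⟨ count-cong (λ us → trans (cong not (swap (Φa us) (sign g) _))
                                (trans (not-distribˡ-xor (sign g) _)
                                       (cong (not (sign g) xor_) (⨁₂-productBit a b us (units g)))))
                  (uvecs (suc n)) ⟩
  xorCount (productBit a b) (not (sign g)) (units g) ∎
  where
  Φa Φb : Vec U (suc n) → Bool
  Φa us = ⨁ (choice a) us
  Φb us = sign g xor (⨁ notOne us xor (⨁₂ signU us (units g) xor ⨁ (choice b) (zipWith mulU us (units g))))
  P : Bool → Vec U (suc n) → Bool
  P c us = (c xor Φa us) ∧ (c xor Φb us)
  coords : ∀ x → X a x ∧ X b (mulG (invG x) g) ≡ P (sign x) (units x)
  coords x = cong (X a x ∧_) (X-inverse-product b x g)
  𝟙-agree : ∀ a b → 𝟙 ((false xor a) ∧ (false xor b)) + 𝟙 ((true xor a) ∧ (true xor b)) ≡ 𝟙 (not (a xor b))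
  𝟙-agree false false = refl
  𝟙-agree false true = refl
  𝟙-agree true false = refl
  𝟙-agree true true = refl
  swap : ∀ a s R → a xor (s xor R) ≡ s xor (a xor R)
  swap = RingSolver.solve-∀ 𝔽₂

profile : (U → U → Bool) → U → ℕ × ℕ
profile d v = count (λ u → not (d u v)) allU , count (λ u → d u v) allU

xorCount-∷ : ∀ d β v {n} (w : Vec U n) {a b} → profile d v ≡ (a , b) →
  xorCount d β (v ∷ w) ≡ a * xorCount d β w + b * xorCount d (not β) w
xorCount-∷ d β v {n} w {a} {b} prof = begin
  xorCount d β (v ∷ w)
    ≡⟨ count-uvecs n _ ⟩
  Σᵤ (λ u → count (λ us → β xor (d u v xor ⨁₂ d us w)) (uvecs n))
    ≡⟨ cong sum (map-cong (λ u → count-cong (λ us → sym (xor-assoc β (d u v) (⨁₂ d us w))) (uvecs n)) allU) ⟩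
  Σᵤ (λ u → xorCount d (β xor d u v) w)
    ≡⟨ sum-map-xor (λ β′ → xorCount d β′ w) β (λ u → d u v) allU ⟩
  proj₁ (profile d v) * xorCount d β w + proj₂ (profile d v) * xorCount d (not β) w
    ≡⟨ cong₂ (λ a b → a * xorCount d β w + b * xorCount d (not β) w) (cong proj₁ prof) (cong proj₂ prof) ⟩
  a * xorCount d β w + b * xorCount d (not β) w ∎

xorCount-complement : ∀ d β {n} (w : Vec U n) → xorCount d β w + xorCount d (not β) w ≡ 4 ^ n
xorCount-complement d β {n} w = begin
  xorCount d β w + xorCount d (not β) w
    ≡⟨ cong (xorCount d β w +_) (count-cong (λ us → sym (not-distribˡ-xor β (⨁₂ d us w))) (uvecs n)) ⟩
  count bit (uvecs n) + count (not ∘ bit) (uvecs n)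
    ≡⟨ count-complement bit (uvecs n) ⟩
  length (uvecs n)
    ≡⟨ length-uvecs n ⟩
  4 ^ n ∎
  where
  bit : Vec U n → Bool
  bit us = β xor ⨁₂ d us w

-- The product X α X (opposite α)

RDSProfile : (U → U → Bool) → Set
RDSProfile d = ∀ v → profile d v ≡ (if isOne v then (4 , 0) else (2 , 2))

productBit-opposite-profile : ∀ α → RDSProfile (productBit α (opposite α))
productBit-opposite-profile zero u1 = refl
productBit-opposite-profile zero ui = refl
productBit-opposite-profile zero uj = refl
productBit-opposite-profile zero uk = refl
productBit-opposite-profile (suc zero) u1 = refl
productBit-opposite-profile (suc zero) ui = refl
productBit-opposite-profile (suc zero) uj = refl
productBit-opposite-profile (suc zero) uk = refl

module _ {d : U → U → Bool} (prof : RDSProfile d) where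

  xorCount-allOne : ∀ β {n} (w : Vec U n) → allOne w ≡ true → xorCount d β w ≡ (if β then 4 ^ n else 0)
  xorCount-allOne false [] _ = refl
  xorCount-allOne true [] _ = refl
  xorCount-allOne β {suc n} (u1 ∷ w) h = begin
    xorCount d β (u1 ∷ w)                             ≡⟨ xorCount-∷ d β u1 w (prof u1) ⟩
    4 * xorCount d β w + 0 * xorCount d (not β) w     ≡⟨ cong (λ c → 4 * c + 0) (xorCount-allOne β w h) ⟩
    4 * (if β then 4 ^ n else 0) + 0                  ≡⟨ +-identityʳ _ ⟩
    4 * (if β then 4 ^ n else 0)                      ≡⟨ if-float (4 *_) β ⟩
    (if β then 4 ^ suc n else 0) ∎

  xorCount-balanced : ∀ β v {n} (w : Vec U n) → profile d v ≡ (2 , 2) → xorCount d β (v ∷ w) ≡ 2 * 4 ^ n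
  xorCount-balanced β v {n} w p = begin
    xorCount d β (v ∷ w)                              ≡⟨ xorCount-∷ d β v w p ⟩
    2 * xorCount d β w + 2 * xorCount d (not β) w     ≡⟨ *-distribˡ-+ 2 (xorCount d β w) _ ⟨
    2 * (xorCount d β w + xorCount d (not β) w)       ≡⟨ cong (2 *_) (xorCount-complement d β w) ⟩
    2 * 4 ^ n ∎

  xorCount-not-allOne : ∀ β {n} (w : Vec U (suc n)) → allOne w ≡ false → xorCount d β w ≡ 2 * 4 ^ n
  xorCount-not-allOne β (u1 ∷ []) ()
  xorCount-not-allOne β {suc n} (u1 ∷ w@(_ ∷ _)) h = begin
    xorCount d β (u1 ∷ w)                             ≡⟨ xorCount-∷ d β u1 w (prof u1) ⟩
    4 * xorCount d β w + 0 * xorCount d (not β) w     ≡⟨ cong (λ c → 4 * c + 0) (xorCount-not-allOne β w h) ⟩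
    4 * (2 * 4 ^ n) + 0                               ≡⟨ regroup (4 ^ n) ⟩
    2 * 4 ^ suc n ∎
    where
    regroup : ∀ a → 4 * (2 * a) + 0 ≡ 2 * (4 * a)
    regroup = solve-∀
  xorCount-not-allOne β (ui ∷ w) _ = xorCount-balanced β ui w (prof ui)
  xorCount-not-allOne β (uj ∷ w) _ = xorCount-balanced β uj w (prof uj)
  xorCount-not-allOne β (uk ∷ w) _ = xorCount-balanced β uk w (prof uk)

-- The product X α X α

LinkedProfile : (U → U → Bool) → (U → Bool) → Set
LinkedProfile d f = ∀ v → profile d v ≡ (if f v then (1 , 3) else (3 , 1))

productBit-self-profile : ∀ α → LinkedProfile (productBit α α) (choice (opposite α))
productBit-self-profile zero u1 = refl
productBit-self-profile zero ui = refl
productBit-self-profile zero uj = refl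
productBit-self-profile zero uk = refl
productBit-self-profile (suc zero) u1 = refl
productBit-self-profile (suc zero) ui = refl
productBit-self-profile (suc zero) uj = refl
productBit-self-profile (suc zero) uk = refl

linkedCount : ℕ → Bool → ℕ
linkedCount zero e = 𝟙 e
linkedCount (suc n) e = 3 * linkedCount n e + linkedCount n (not e)

xorCount-linked : ∀ {d f} → LinkedProfile d f →
  ∀ β {n} (w : Vec U n) → xorCount d β w ≡ linkedCount n (β xor ⨁ f w)
xorCount-linked prof β [] = +-identityʳ _
xorCount-linked {d} {f} prof β {suc n} (v ∷ w) = begin
  xorCount d β (v ∷ w)
    ≡⟨ xorCount-∷ d β v w (prof v) ⟩
  proj₁ p * xorCount d β w + proj₂ p * xorCount d (not β) w
    ≡⟨ cong₂ (λ x y → proj₁ p * x + proj₂ p * y)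
             (xorCount-linked prof β w)
             (trans (xorCount-linked prof (not β) w) (cong (linkedCount n) (sym (not-distribˡ-xor β E)))) ⟩
  proj₁ p * linkedCount n (β xor E) + proj₂ p * linkedCount n (not (β xor E))
    ≡⟨ step (f v) (β xor E) ⟩
  linkedCount (suc n) (f v xor (β xor E))
    ≡⟨ cong (linkedCount (suc n)) (swap (f v) β E) ⟩
  linkedCount (suc n) (β xor (f v xor E)) ∎
  where
  E = ⨁ f w
  p = if f v then (1 , 3) else (3 , 1)
  swap : ∀ a b c → a xor (b xor c) ≡ b xor (a xor c)
  swap = RingSolver.solve-∀ 𝔽₂
  step : ∀ fv e → let (a , b) = if fv then (1 , 3) else (3 , 1) in
    a * linkedCount n e + b * linkedCount n (not e) ≡ linkedCount (suc n) (fv xor e)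
  step false e = cong (3 * linkedCount n e +_) (+-identityʳ (linkedCount n (not e)))
  step true e = begin
    1 * linkedCount n e + 3 * linkedCount n (not e)   ≡⟨ cong (_+ 3 * linkedCount n (not e)) (+-identityʳ (linkedCount n e)) ⟩
    linkedCount n e + 3 * linkedCount n (not e)       ≡⟨ +-comm (linkedCount n e) _ ⟩
    3 * linkedCount n (not e) + linkedCount n e       ≡⟨ cong (λ e′ → 3 * linkedCount n (not e) + linkedCount n e′) (not-involutive e) ⟨
    linkedCount (suc n) (not e) ∎

linkedCount-closed : ∀ n → linkedCount (suc n) true ≡ 2 * 4 ^ n + 2 ^ n × linkedCount (suc n) false + 2 ^ n ≡ 2 * 4 ^ n
linkedCount-closed zero = refl , refl
linkedCount-closed (suc n) with linkedCount-closed n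
... | ν≡ , μ+b≡ = agree , disagree
  where
  ν = linkedCount (suc n) true
  μ = linkedCount (suc n) false
  b = 2 ^ n
  f = 4 ^ n
  agree : 3 * ν + μ ≡ 2 * (4 * f) + 2 * b
  agree = begin
    3 * ν + μ                  ≡⟨ cong (λ x → 3 * x + μ) ν≡ ⟩
    3 * (2 * f + b) + μ        ≡⟨ regroup f b μ ⟩
    6 * f + 2 * b + (μ + b)    ≡⟨ cong (6 * f + 2 * b +_) μ+b≡ ⟩
    6 * f + 2 * b + 2 * f      ≡⟨ collect f b ⟩
    2 * (4 * f) + 2 * b ∎
    where
    regroup : ∀ f b μ → 3 * (2 * f + b) + μ ≡ 6 * f + 2 * b + (μ + b)
    regroup = solve-∀
    collect : ∀ f b → 6 * f + 2 * b + 2 * f ≡ 2 * (4 * f) + 2 * b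
    collect = solve-∀
  disagree : 3 * μ + ν + 2 * b ≡ 2 * (4 * f)
  disagree = begin
    3 * μ + ν + 2 * b          ≡⟨ cong (λ x → 3 * μ + x + 2 * b) ν≡ ⟩
    3 * μ + (2 * f + b) + 2 * b ≡⟨ regroup μ f b ⟩
    3 * (μ + b) + 2 * f        ≡⟨ cong (λ x → 3 * x + 2 * f) μ+b≡ ⟩
    3 * (2 * f) + 2 * f        ≡⟨ collect f ⟩
    2 * (4 * f) ∎
    where
    regroup : ∀ μ f b → 3 * μ + (2 * f + b) + 2 * b ≡ 3 * (μ + b) + 2 * f
    regroup = solve-∀
    collect : ∀ f → 3 * (2 * f) + 2 * f ≡ 2 * (4 * f)
    collect = solve-∀

module _ (n : ℕ) where

  k λ′ μ ν : ℕ
  k = 2 ^ (2 * suc n)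
  λ′ = 2 ^ (2 * suc n ∸ 1)
  ν = 2 ^ (2 * suc n ∸ 1) + 2 ^ (suc n ∸ 1)
  μ = ν ∸ 2 ^ suc n

  λ′≡2*4^n : λ′ ≡ 2 * 4 ^ n
  λ′≡2*4^n = trans (cong (2 ^_) (+-suc n (n + 0))) (cong (2 *_) (sym (4^≡2^2* n)))

  linkedCount-true : linkedCount (suc n) true ≡ ν
  linkedCount-true = trans (proj₁ (linkedCount-closed n)) (cong (_+ 2 ^ n) (sym λ′≡2*4^n))

  linkedCount-false : linkedCount (suc n) false ≡ μ
  linkedCount-false = begin
    m                                  ≡⟨ m+n∸n≡m m (2 * b) ⟨
    m + 2 * b ∸ 2 * b                  ≡⟨ cong (_∸ 2 * b) (regroup m b) ⟩
    m + b + b ∸ 2 * b                  ≡⟨ cong (λ x → x + b ∸ 2 * b) (proj₂ (linkedCount-closed n)) ⟩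
    2 * 4 ^ n + b ∸ 2 * b              ≡⟨ cong (λ x → x + b ∸ 2 * b) λ′≡2*4^n ⟨
    λ′ + b ∸ 2 * b ∎
    where
    m = linkedCount (suc n) false
    b = 2 ^ n
    regroup : ∀ m b → m + 2 * b ≡ m + b + b
    regroup = solve-∀

  X-product-opposite : ∀ α → ProdEqRDS {suc n} centre (X α) (X (opposite α)) k λ′
  X-product-opposite α g = begin
    coef (X α) (X (opposite α)) g
      ≡⟨ coef-xorCount n α (opposite α) g ⟩
    xorCount (productBit α (opposite α)) (not (sign g)) (units g)
      ≡⟨ by-units (allOne (units g)) refl ⟩
    (if allOne (units g) ∧ not (sign g) then k else 0) + (if allOne (units g) then 0 else λ′)
      ≡⟨ cong₂ (λ e c → (if e then k else 0) + (if c then 0 else λ′)) (isE-split g) (centre-units n g) ⟨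
    (if isE g then k else 0) + (if centre g then 0 else λ′) ∎
    where
    by-sign : ∀ s → (if not s then 4 ^ suc n else 0) ≡ (if not s then k else 0) + 0
    by-sign false = trans (4^≡2^2* (suc n)) (sym (+-identityʳ k))
    by-sign true = refl
    by-units : ∀ a → allOne (units g) ≡ a → xorCount (productBit α (opposite α)) (not (sign g)) (units g)
                                          ≡ (if a ∧ not (sign g) then k else 0) + (if a then 0 else λ′)
    by-units true eq =
      trans (xorCount-allOne (productBit-opposite-profile α) (not (sign g)) (units g) eq) (by-sign (sign g))
    by-units false eq =
      trans (xorCount-not-allOne (productBit-opposite-profile α) (not (sign g)) (units g) eq) (sym λ′≡2*4^n)

  X-product-self : ∀ α → ProdEqLinked {suc n} (X α) (X α) (X (opposite α)) μ ν
  X-product-self α g = begin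
    coef (X α) (X α) g
      ≡⟨ coef-xorCount n α α g ⟩
    xorCount (productBit α α) (not (sign g)) (units g)
      ≡⟨ xorCount-linked (productBit-self-profile α) (not (sign g)) (units g) ⟩
    linkedCount (suc n) (not (sign g) xor ⨁ (choice (opposite α)) (units g))
      ≡⟨ cong (linkedCount (suc n)) (not-distribˡ-xor (sign g) _) ⟨
    linkedCount (suc n) (not (X (opposite α) g))
      ≡⟨ by-membership (X (opposite α) g) ⟩
    (if X (opposite α) g then μ else ν) ∎
    where
    by-membership : ∀ b → linkedCount (suc n) (not b) ≡ (if b then μ else ν)
    by-membership false = linkedCount-true
    by-membership true = linkedCount-false

  X-isRDS : ∀ α → IsRDS {suc n} centre k 2 k λ′ (X α)
  X-isRDS α =
    (λ g → trans (count-cong (λ x → cong (X α x ∧_) (X-inv α (mulG (invG x) g))) (elems (suc n)))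
                 (X-product-opposite α g))
    , size-X n α , size-centre n , length-elems n , m^n>0 2 (2 * suc n ∸ 1)

opposite-bijective : ∀ {n} → Bijective _≡_ _≡_ (opposite {n})
opposite-bijective = inverseᵇ⇒bijective {f⁻¹ = opposite}
  (strictlyInverseˡ⇒inverseˡ opposite opposite-involutive , strictlyInverseʳ⇒inverseʳ opposite opposite-involutive)

≢opposite⇒≡ : ∀ (α β : Fin 2) → β ≢ opposite α → β ≡ α
≢opposite⇒≡ zero zero _ = refl
≢opposite⇒≡ zero (suc zero) β≢ = contradiction refl β≢
≢opposite⇒≡ (suc zero) zero β≢ = contradiction refl β≢
≢opposite⇒≡ (suc zero) (suc zero) _ = refl

proposition7p7 : (r : ℕ) → 1 ≤ r →
    Σ (Fin 2 → Subset r) (λ X →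
      (∀ α → Semiregular centre (X α))
      × ClosedLinkedSystem centre
          (2 ^ (2 * r)) 2 (2 ^ (2 * r)) (2 ^ (2 * r ∸ 1)) 2
          ((2 ^ (2 * r ∸ 1) + 2 ^ (r ∸ 1)) ∸ 2 ^ r)
          (2 ^ (2 * r ∸ 1) + 2 ^ (r ∸ 1))
          X)
proposition7p7 zero ()
proposition7p7 (suc n) _ = X , X-semiregular n , record
  { two≤s = s≤s (s≤s z≤n)
  ; welldef = X-welldefined
  ; rds = X-isRDS n
  ; χ = opposite
  ; χ-bij = opposite-bijective
  ; ψ = λ α _ _ → opposite α
  ; inverse = X-inv
  ; prod-χ = X-product-opposite n
  ; prod-ψ = λ α β β≢ → subst (λ β → ProdEqLinked (X α) (X β) (X (opposite α)) _ _)
                              (sym (≢opposite⇒≡ α β β≢)) (X-product-self n α)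
  }
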